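{- Let $L$ be a complete lattice, $F\colon L\to L$ an $\omega$-continuous function, and $\alpha\in L$. (1) Negative LT-PDR (described in the context) is sound: if it outputs `False', then $\mu F\not\le\alpha$. (2) If $\mu F\not\le\alpha$, then negative LT-PDR is weakly terminating: for suitable choices of the elements $x$ in applications of Candidate and Decide, the algorithm terminates.
   Context: $\omega$-continuous means preserving suprema of increasing $\omega$-chains; $\mu F$ is the least fixed point. Negative LT-PDR: its data is a finite sequence $C=(C_0,\dots,C_{n-1})$ in $L$, initially empty. It repeatedly applies, nondeterministically, one applicable rule until a value is returned: Candidate: choose $x\in L$ with $x\not\le\alpha$ and set $C:=(x)$. Model: if $C$ is nonempty and $C_0=\bot$, return `False' (with $C$). Decide: if there exists $x\in L$ with $C_0\le Fx$, set $C:=(x,C_0,\dots,C_{n-1})$ for such an $x$. -}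

module Defs where

open import Level using (Level; _⊔_; suc)
open import Data.Nat using (ℕ) renaming (suc to sucℕ)
open import Data.Product using (Σ; ∃; _×_; _,_)
open import Data.List using (List; []; _∷_)
open import Relation.Nullary using (¬_)
open import Relation.Unary using (Pred)
open import Relation.Binary.Bundles using (Poset)
open import Relation.Binary.PropositionalEquality using (_≡_)
open import Relation.Binary.Construct.Closure.ReflexiveTransitive using (Star)

-- Subsets are predicates on the carrier at level c ⊔ ℓ₁ ⊔ ℓ₂ (large enough to
-- contain images of ω-chains and sets such as {x | F x ≤ x}).
record CompleteLattice (c ℓ₁ ℓ₂ : Level) : Set (suc (c ⊔ ℓ₁ ⊔ ℓ₂)) where
  field
    poset : Poset c ℓ₁ ℓ₂
  open Poset poset public
  field
    ⋁      : Pred Carrier (c ⊔ ℓ₁ ⊔ ℓ₂) → Carrier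
    ⋁-ub   : ∀ (S : Pred Carrier (c ⊔ ℓ₁ ⊔ ℓ₂)) {x} → S x → x ≤ ⋁ S
    ⋁-least : ∀ (S : Pred Carrier (c ⊔ ℓ₁ ⊔ ℓ₂)) {y} → (∀ {x} → S x → x ≤ y) → ⋁ S ≤ y

  ⊥L : Carrier
  ⊥L = ⋁ (λ _ → Lift′)
    where
    open import Data.Empty.Polymorphic using () renaming (⊥ to Lift′)

  Image : (ℕ → Carrier) → Pred Carrier (c ⊔ ℓ₁ ⊔ ℓ₂)
  Image f y = Level.Lift (c ⊔ ℓ₂) (∃ λ n → y ≈ f n)

  ⋁ω : (ℕ → Carrier) → Carrier
  ⋁ω f = ⋁ (Image f)

  IncreasingChain : (ℕ → Carrier) → Set ℓ₂
  IncreasingChain f = ∀ n → f n ≤ f (sucℕ n)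

module _ {c ℓ₁ ℓ₂} (L : CompleteLattice c ℓ₁ ℓ₂) where
  open CompleteLattice L

  -- F is ω-continuous: it preserves suprema of increasing ω-chains
  -- (we also require F to respect the lattice equality ≈; this is implied
  -- by ω-continuity applied to constant chains).
  record OmegaContinuous (F : Carrier → Carrier) : Set (c ⊔ ℓ₁ ⊔ ℓ₂) where
    field
      cong       : ∀ {x y} → x ≈ y → F x ≈ F y
      preserves  : ∀ (f : ℕ → Carrier) → IncreasingChain f →
                   F (⋁ω f) ≈ ⋁ω (λ n → F (f n))

  record IsLeastFixedPoint (F : Carrier → Carrier) (m : Carrier) : Set (c ⊔ ℓ₁ ⊔ ℓ₂) where
    field
      fixed : F m ≈ m
      least : ∀ x → F x ≈ x → m ≤ x

  -- Negative LT-PDR.  A state is the sequence C = (C₀,…,C_{n-1}), a list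
  -- whose head is C₀.  One step = one application of the Candidate or the
  -- Decide rule.
  data NegStep (F : Carrier → Carrier) (α : Carrier) : List Carrier → List Carrier → Set (c ⊔ ℓ₁ ⊔ ℓ₂) where
    candidate : ∀ {C} x → ¬ (x ≤ α) → NegStep F α C (x ∷ [])
    decide    : ∀ {C₀ C} x → C₀ ≤ F x → NegStep F α (C₀ ∷ C) (x ∷ C₀ ∷ C)

  ModelReturnsFalse : List Carrier → Set (c ⊔ ℓ₁)
  ModelReturnsFalse C = Σ Carrier λ C₀ → Σ (List Carrier) λ C' → (C ≡ C₀ ∷ C') × (C₀ ≈ ⊥L)

  Reachable : (F : Carrier → Carrier) (α : Carrier) → List Carrier → Set (c ⊔ ℓ₁ ⊔ ℓ₂)
  Reachable F α C = Star (NegStep F α) [] C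

  OutputsFalse : (F : Carrier → Carrier) (α : Carrier) → List Carrier → Set (c ⊔ ℓ₁ ⊔ ℓ₂)
  OutputsFalse F α C = Reachable F α C × ModelReturnsFalse C

{-# OPTIONS --safe #-}
module Submission where

-- Soundness: "the head of C is below p implies p ≰ α" holds after Candidate
-- and is pulled back along Decide (C₀ ≤ F x ≤ F p ≤ p) for any prefixed
-- point p; a head ⊥L ≤ p then refutes p ≤ α, in particular for p = μF.
-- Weak termination: μF lies below the Kleene supremum ⋁ₙ Fⁿ⊥, so if μF ≰ α
-- some Fⁿ⊥ ≰ α (this is where excluded middle enters); choose it as the
-- candidate and descend the Kleene chain Fⁿ⊥, Fⁿ⁻¹⊥, …, ⊥ with Decide.

open import Defs
open import Level using (Level; _⊔_; Lift; lift; lower)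
open import Data.Product using (_×_; ∃; _,_)
open import Data.List using (List; []; _∷_)
open import Data.Nat using (ℕ; zero; suc)
open import Data.Unit.Polymorphic using (⊤)
open import Function using (_∘_; id)
open import Relation.Nullary using (¬_)
open import Relation.Nullary.Decidable using (map′; decidable-stable)
open import Relation.Unary using (Pred)
open import Axiom.ExcludedMiddle using (ExcludedMiddle)
open import Relation.Binary.PropositionalEquality using () renaming (refl to ≡-refl)
open import Relation.Binary.Construct.Closure.ReflexiveTransitive
  using (Star; ε; _◅_; _◅◅_; fold)

lower-excludedMiddle : ∀ {a} b → ExcludedMiddle (a ⊔ b) → ExcludedMiddle a
lower-excludedMiddle b em {P} = map′ lower lift (em {Lift b P})

¬∀⇒∃¬ : ∀ {a p} {A : Set a} {P : Pred A p} → ExcludedMiddle (a ⊔ p) →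
        ¬ (∀ x → P x) → ∃ λ x → ¬ P x
¬∀⇒∃¬ {a} {p} em ¬∀P =
  decidable-stable em λ ¬∃¬P →
    ¬∀P λ x → decidable-stable (lower-excludedMiddle a em) λ ¬Px → ¬∃¬P (x , ¬Px)

module _ {c ℓ₁ ℓ₂ : Level} (L : CompleteLattice c ℓ₁ ℓ₂) where
  open CompleteLattice L

  ⊥L-least : ∀ {x} → ⊥L ≤ x
  ⊥L-least = ⋁-least _ λ ()

  ⋁ω-ub : ∀ (g : ℕ → Carrier) n → g n ≤ ⋁ω g
  ⋁ω-ub g n = ⋁-ub (Image g) (lift (n , Eq.refl))

  ⋁ω-least : ∀ (g : ℕ → Carrier) {y} → (∀ n → g n ≤ y) → ⋁ω g ≤ y
  ⋁ω-least g g≤y = ⋁-least (Image g) λ { (lift (n , x≈gn)) → ≤-respˡ-≈ (Eq.sym x≈gn) (g≤y n) }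

  ⋁ω-shift : ∀ (g : ℕ → Carrier) → IncreasingChain g → ⋁ω (g ∘ suc) ≈ ⋁ω g
  ⋁ω-shift g g↑ = antisym
    (⋁ω-least (g ∘ suc) λ n → ⋁ω-ub g (suc n))
    (⋁ω-least g λ n → trans (g↑ n) (⋁ω-ub (g ∘ suc) n))

  Monotone : (Carrier → Carrier) → Set (c ⊔ ℓ₂)
  Monotone F = ∀ {x y} → x ≤ y → F x ≤ F y

  -- Continuity applied to the two-step chain x, y, y, … .
  ω-continuous⇒monotone : ∀ {F} → OmegaContinuous L F → Monotone F
  ω-continuous⇒monotone {F} oc {x} {y} x≤y =
    trans (⋁ω-ub (F ∘ g) 0)
          (reflexive (Eq.trans (Eq.sym (preserves g g↑)) (cong ⋁ω-g≈y)))
    where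
    open OmegaContinuous oc
    g : ℕ → Carrier
    g zero    = x
    g (suc _) = y
    g↑ : IncreasingChain g
    g↑ zero    = x≤y
    g↑ (suc _) = refl
    ⋁ω-g≈y : ⋁ω g ≈ y
    ⋁ω-g≈y = antisym (⋁ω-least g λ { zero → x≤y ; (suc _) → refl }) (⋁ω-ub g 1)

  kleene : (Carrier → Carrier) → ℕ → Carrier
  kleene F zero    = ⊥L
  kleene F (suc n) = F (kleene F n)

  kleene-increasing : ∀ {F} → Monotone F → IncreasingChain (kleene F)
  kleene-increasing mono zero    = ⊥L-least
  kleene-increasing mono (suc n) = mono (kleene-increasing mono n)

  ⋁ω-kleene-fixed : ∀ {F} → OmegaContinuous L F → F (⋁ω (kleene F)) ≈ ⋁ω (kleene F)
  ⋁ω-kleene-fixed {F} oc = Eq.trans (OmegaContinuous.preserves oc (kleene F) kleene↑)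
                                    (⋁ω-shift (kleene F) kleene↑)
    where kleene↑ = kleene-increasing (ω-continuous⇒monotone oc)

  lfp-below-kleene-bound : ∀ {F μF α} → OmegaContinuous L F → IsLeastFixedPoint L F μF →
                           (∀ n → kleene F n ≤ α) → μF ≤ α
  lfp-below-kleene-bound {F} oc lfp kleene≤α =
    trans (IsLeastFixedPoint.least lfp _ (⋁ω-kleene-fixed oc)) (⋁ω-least (kleene F) kleene≤α)

  module _ {F : Carrier → Carrier} {α : Carrier} where

    HeadBelowRefutes : Carrier → List Carrier → Set (c ⊔ ℓ₁ ⊔ ℓ₂)
    HeadBelowRefutes p []      = ⊤
    HeadBelowRefutes p (x ∷ _) = Lift (c ⊔ ℓ₁) (x ≤ p → ¬ p ≤ α)

    step-preserves : ∀ {p} → Monotone F → F p ≤ p →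
                     ∀ {C D} → NegStep L F α C D → HeadBelowRefutes p C → HeadBelowRefutes p D
    step-preserves mono Fp≤p (candidate x x≰α) _ = lift λ x≤p p≤α → x≰α (trans x≤p p≤α)
    step-preserves mono Fp≤p (decide x C₀≤Fx) (lift refute) =
      lift λ x≤p → refute (trans C₀≤Fx (trans (mono x≤p) Fp≤p))

    outputsFalse⇒prefixed-point≰α : ∀ {p} → Monotone F → F p ≤ p →
                                    ∀ C → OutputsFalse L F α C → ¬ p ≤ α
    outputsFalse⇒prefixed-point≰α {p} mono Fp≤p C (run , (C₀ , C′ , ≡-refl , C₀≈⊥)) =
      lower (invariant run _) (≤-respˡ-≈ (Eq.sym C₀≈⊥) ⊥L-least)
      where
      invariant : Star (NegStep L F α) [] C → HeadBelowRefutes p [] → HeadBelowRefutes p C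
      invariant = fold (λ C D → HeadBelowRefutes p C → HeadBelowRefutes p D)
                       (λ s k → k ∘ step-preserves mono Fp≤p s) id

    descend-kleene : ∀ n {C} → Reachable L F α (kleene F n ∷ C) → ∃ λ C′ → Reachable L F α (⊥L ∷ C′)
    descend-kleene zero    run = _ , run
    descend-kleene (suc n) run = descend-kleene n (run ◅◅ decide (kleene F n) refl ◅ ε)

    kleene≰α⇒outputsFalse : ∀ n → ¬ kleene F n ≤ α → ∃ λ C → OutputsFalse L F α C
    kleene≰α⇒outputsFalse n kleene≰α with descend-kleene n (candidate (kleene F n) kleene≰α ◅ ε)
    ... | C′ , run = ⊥L ∷ C′ , run , (⊥L , C′ , ≡-refl , Eq.refl)

theorem6 : ∀ {c ℓ₁ ℓ₂ : Level} (L : CompleteLattice c ℓ₁ ℓ₂)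
             (F : CompleteLattice.Carrier L → CompleteLattice.Carrier L)
             (α : CompleteLattice.Carrier L) →
             OmegaContinuous L F →
             (μF : CompleteLattice.Carrier L) → IsLeastFixedPoint L F μF →
             -- (1) soundness
             (∀ (C : List (CompleteLattice.Carrier L)) → OutputsFalse L F α C →
                ¬ (CompleteLattice._≤_ L μF α))
             ×
             -- (2) weak termination (classical metatheory made explicit)
             (ExcludedMiddle (c Level.⊔ ℓ₁ Level.⊔ ℓ₂) →
                ¬ (CompleteLattice._≤_ L μF α) →
                ∃ λ (C : List (CompleteLattice.Carrier L)) → OutputsFalse L F α C)
theorem6 {c} {ℓ₁} {ℓ₂} L F α oc μF lfp = soundness , weak-termination
  where
  open CompleteLattice L
  soundness : ∀ C → OutputsFalse L F α C → ¬ μF ≤ α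
  soundness = outputsFalse⇒prefixed-point≰α L (ω-continuous⇒monotone L oc)
                (reflexive (IsLeastFixedPoint.fixed lfp))
  weak-termination : ExcludedMiddle (c ⊔ ℓ₁ ⊔ ℓ₂) → ¬ μF ≤ α → ∃ λ C → OutputsFalse L F α C
  weak-termination em μF≰α
    with ¬∀⇒∃¬ (lower-excludedMiddle (c ⊔ ℓ₁) em) (μF≰α ∘ lfp-below-kleene-bound L oc lfp)
  ... | n , kleene≰α = kleene≰α⇒outputsFalse L n kleene≰α
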